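{- Let $G$ be a finite graph and $\rho\in\mathcal O(G)$. Then $\#[\rho]_{ce}=\#[\rho]_{cu}\cdot\#[\rho]_{eu}$, and $\#[\rho]_{ce}=\bar\kappa_\rho(G;1,1)$, i.e. $\#[\rho]_{ce}$ equals the number of pairs $(f,g)$ where $f$ is a $\{0,1\}$-valued tension of $(G,\rho)$ and $g$ is a $\{0,1\}$-valued flow of $(G,\rho)$.
   Context: $G=(V,E)$ is a finite graph, loops and multiple edges allowed. An orientation chooses for each edge one of its two directions (loops also have two); $\mathcal O(G)$ is the set of orientations; $E(\rho\neq\sigma)$ is the set of edges where $\rho,\sigma$ differ. An integer flow of $(G,\rho)$ is $g:E\to\mathbb Z$ with, at each vertex, sum over incoming edges equal to sum over outgoing edges; an integer tension is $f:E\to\mathbb Z$ with $f(e)=h(u)-h(v)$ for each edge directed from $u$ to $v$, for some $h:V\to\mathbb Z$. A bond is a minimal nonempty edge set $[S,V\setminus S]$, directed if all its edges point the same way across. A locally directed cut is an edge set $[S,V\setminus S]$ with an orientation making it a disjoint union of directed bonds; a directed Eulerian subgraph is an edge set with an orientation having equal in- and out-degree at each vertex. $\sigma\sim_{cu}\rho$ (cut equivalence) if $E(\rho\ne\sigma)$ oriented by $\rho$ is a locally directed cut (possibly empty); $\sigma\sim_{eu}\rho$ (Eulerian equivalence) if it is a directed Eulerian subgraph (possibly empty); $\sigma\sim_{ce}\rho$ (cut-Eulerian equivalence) if it is a disjoint union of a locally directed cut and a directed Eulerian subgraph (either possibly empty). $[\rho]_{cu},[\rho]_{eu},[\rho]_{ce}$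 are the respective equivalence classes of $\rho$ in $\mathcal O(G)$. For nonnegative integers $p,q$, $\bar\kappa_\rho(G;p,q)$ is the number of pairs $(f,g)$ (integer tension, integer flow of $(G,\rho)$) with $0\le f(e)\le p$, $0\le g(e)\le q$ for all $e$. -}

module Defs where

open import Data.Nat using (ℕ; zero; suc)
open import Data.Integer as ℤ using (ℤ; 0ℤ; _-_; _≤_)
open import Data.Bool using (Bool; true; false; _xor_; if_then_else_)
open import Data.Fin using (Fin; zero; suc; _≟_)
open import Data.Fin.Subset using (Subset; _∈_; _⊆_; _∪_; _∩_; ⊥; Nonempty)
open import Data.Vec using (Vec; lookup; tabulate; zipWith)
open import Data.List using (List; length; foldr)
open import Data.List.Membership.Propositional renaming (_∈_ to _∈ˡ_)
open import Data.List.Relation.Unary.All using (All)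
open import Data.List.Relation.Unary.AllPairs using (AllPairs)
open import Data.List.Relation.Unary.Unique.Propositional using (Unique)
open import Data.Product using (Σ; ∃; _×_; _,_; proj₁; proj₂)
open import Data.Sum using (_⊎_)
open import Function.Bundles using (_⇔_)
open import Relation.Binary.PropositionalEquality using (_≡_)
open import Relation.Nullary using (does)

-- A finite graph (loops and multiple edges allowed): vertices Fin nV, edges Fin nE,
-- each edge has an ordered pair of endpoints (a reference direction).
record Graph : Set where
  field
    nV   : ℕ
    nE   : ℕ
    ends : Fin nE → Fin nV × Fin nV
open Graph public

-- An orientation chooses for every edge one of its two directions:
-- true = from proj₁ (ends e) to proj₂ (ends e), false = the reverse.
-- (For a loop, the two directions are still distinct orientations.)
Orientation : Graph → Set
Orientation G = Vec Bool (nE G)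

EdgeSet : Graph → Set
EdgeSet G = Subset (nE G)

VertexSet : Graph → Set
VertexSet G = Subset (nV G)

tl : (G : Graph) → Orientation G → Fin (nE G) → Fin (nV G)
tl G ρ e = if lookup ρ e then proj₁ (ends G e) else proj₂ (ends G e)

hd : (G : Graph) → Orientation G → Fin (nE G) → Fin (nV G)
hd G ρ e = if lookup ρ e then proj₂ (ends G e) else proj₁ (ends G e)

diffSet : (G : Graph) → Orientation G → Orientation G → EdgeSet G
diffSet G ρ σ = zipWith _xor_ ρ σ

cut : (G : Graph) → VertexSet G → EdgeSet G
cut G S = tabulate λ e → lookup S (proj₁ (ends G e)) xor lookup S (proj₂ (ends G e))

IsCut : (G : Graph) → EdgeSet G → Set
IsCut G B = ∃ λ (S : VertexSet G) → cut G S ≡ B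

IsBond : (G : Graph) → EdgeSet G → Set
IsBond G B = IsCut G B × Nonempty B ×
  (∀ B' → IsCut G B' → Nonempty B' → B' ⊆ B → B' ≡ B)

IsDirectedBond : (G : Graph) → Orientation G → EdgeSet G → Set
IsDirectedBond G ρ B = IsBond G B ×
  (∃ λ (S : VertexSet G) → cut G S ≡ B ×
     (∀ e → e ∈ B → (tl G ρ e ∈ S) × (lookup S (hd G ρ e) ≡ false)))

Disjoint : ∀ {k} → Subset k → Subset k → Set
Disjoint p q = p ∩ q ≡ ⊥

IsLocallyDirectedCut : (G : Graph) → Orientation G → EdgeSet G → Set
IsLocallyDirectedCut G ρ C = IsCut G C ×
  (∃ λ (Bs : List (EdgeSet G)) →
     All (IsDirectedBond G ρ) Bs × AllPairs Disjoint Bs × foldr _∪_ ⊥ Bs ≡ C)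

sumFin : ∀ {k} → (Fin k → ℕ) → ℕ
sumFin {zero} f = 0
sumFin {suc k} f = f zero Data.Nat.+ sumFin (λ i → f (suc i))

sumFinℤ : ∀ {k} → (Fin k → ℤ) → ℤ
sumFinℤ {zero} f = 0ℤ
sumFinℤ {suc k} f = f zero ℤ.+ sumFinℤ (λ i → f (suc i))

indeg : (G : Graph) → Orientation G → EdgeSet G → Fin (nV G) → ℕ
indeg G ρ D v = sumFin λ e →
  if lookup D e then (if does (hd G ρ e ≟ v) then 1 else 0) else 0

outdeg : (G : Graph) → Orientation G → EdgeSet G → Fin (nV G) → ℕ
outdeg G ρ D v = sumFin λ e →
  if lookup D e then (if does (tl G ρ e ≟ v) then 1 else 0) else 0

IsDirectedEulerian : (G : Graph) → Orientation G → EdgeSet G → Set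
IsDirectedEulerian G ρ D = ∀ v → indeg G ρ D v ≡ outdeg G ρ D v

CutEquiv : (G : Graph) → Orientation G → Orientation G → Set
CutEquiv G ρ σ = IsLocallyDirectedCut G ρ (diffSet G ρ σ)

EulerEquiv : (G : Graph) → Orientation G → Orientation G → Set
EulerEquiv G ρ σ = IsDirectedEulerian G ρ (diffSet G ρ σ)

CutEulerEquiv : (G : Graph) → Orientation G → Orientation G → Set
CutEulerEquiv G ρ σ = ∃ λ (C : EdgeSet G) → ∃ λ (D : EdgeSet G) →
  IsLocallyDirectedCut G ρ C × IsDirectedEulerian G ρ D ×
  Disjoint C D × C ∪ D ≡ diffSet G ρ σ

HasCount : {A : Set} → (A → Set) → ℕ → Set
HasCount {A} P N = ∃ λ (l : List A) →
  length l ≡ N × Unique l × (∀ x → (x ∈ˡ l) ⇔ P x)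

IsTension : (G : Graph) → Orientation G → Vec ℤ (nE G) → Set
IsTension G ρ f = ∃ λ (h : Fin (nV G) → ℤ) →
  ∀ e → lookup f e ≡ h (tl G ρ e) - h (hd G ρ e)

IsFlow : (G : Graph) → Orientation G → Vec ℤ (nE G) → Set
IsFlow G ρ g = ∀ v →
  sumFinℤ (λ e → if does (hd G ρ e ≟ v) then lookup g e else 0ℤ)
  ≡ sumFinℤ (λ e → if does (tl G ρ e ≟ v) then lookup g e else 0ℤ)

Bounded : ∀ {k} → ℕ → Vec ℤ k → Set
Bounded p f = ∀ e → (0ℤ ≤ lookup f e) × (lookup f e ≤ ℤ.+ p)

KappaBar : (G : Graph) → Orientation G → ℕ → ℕ → ℕ → Set
KappaBar G ρ p q N = HasCount
  (λ (fg : Vec ℤ (nE G) × Vec ℤ (nE G)) →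
     IsTension G ρ (proj₁ fg) × IsFlow G ρ (proj₂ fg) ×
     Bounded p (proj₁ fg) × Bounded q (proj₂ fg))
  N

-- A locally directed cut C and a directed Eulerian subgraph D are disjoint: the
-- indicator of C is a tension, the indicator of D is a flow, and the sum of
-- f(e) g(e) vanishes for every tension f and flow g.  Hence E(ρ ≠ σ) = C ∪ D
-- matches [ρ]_ce with the pairs (C , D), just as E(ρ ≠ σ) matches [ρ]_cu with the
-- locally directed cuts and [ρ]_eu with the directed Eulerian subgraphs, so
-- #[ρ]_ce = #[ρ]_cu · #[ρ]_eu.  The same pairs are counted by κ̄_ρ(G; 1, 1): a
-- {0,1}-valued flow is the indicator of a directed Eulerian subgraph, and a
-- {0,1}-valued tension is the indicator of a locally directed cut, obtained by
-- repeatedly removing the directed cut of an upper level set of a potential;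
-- every directed cut is in turn a disjoint union of directed bonds, by splitting
-- it along any proper subcut.

module Submission where

open import Defs
open import Data.Nat using (ℕ; _*_)
open import Data.Product using (∃; _×_)
open import Relation.Binary.PropositionalEquality using (_≡_)

open import Algebra.Bundles using (CommutativeRing)
open import Data.Bool using (Bool; true; false; not; _∧_; _∨_; _xor_; if_then_else_)
open import Data.Bool.Properties
  using (∧-identityʳ; ∧-zeroʳ; ¬-not; xor-assoc; xor-comm; xor-identityʳ; xor-same; xor-∧-commutativeRing)
  renaming (_≟_ to _≟ᵇ_)
open import Algebra.Properties.CommutativeSemigroup (CommutativeRing.+-commutativeSemigroup xor-∧-commutativeRing)
  using (interchange)
open import Data.Nat as ℕ using (zero; suc; z≤n; s≤s)
import Data.Nat.Properties as ℕ
open import Data.Integer using (ℤ; +_; -[1+_]; 0ℤ; _-_; _≤_; +≤+) renaming (_+_ to _+ℤ_; _*_ to _*ℤ_)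
import Data.Integer.Properties as ℤ
open import Data.Integer.Tactic.RingSolver using (solve-∀)
open import Algebra.Properties.Semiring.Sum ℤ.+-*-semiring
  using (sum-syntax; ∑-comm; ∑-distrib-+; *-distribˡ-sum; sum-cong-≗; sum-replicate-zero)
open import Data.Fin using (Fin; zero; suc)
open import Data.Fin.Properties using (_≟_; all?)
open import Data.Fin.Subset
  using (Subset; inside; outside; _∈_; _∉_; _⊆_; _⊂_; ∁; _∪_; _∩_; _─_; ⋃; Nonempty) renaming (⊥ to ∅)
open import Data.Fin.Subset.Properties
  using (Empty-unique; ∉⊥; _∈?_; nonempty?; _⊆?_; _⊂?_; anySubset?; x∈p∩q⁺; x∈p∩q⁻; x∈p∪q⁻; x∈∁p⇒x∉p;
         ⊆-refl; ⊆-antisym; ⊂-irref; p⊆p∪q; q⊆p∪q; p∩q⊆p; p∪∁p≡⊤; p∩q≢∅⇒p─q⊂p;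
         ∪-assoc; ∪-comm; ∪-identityˡ; ∪-identityʳ; ∩-identityʳ; ∩-zeroʳ; ∩-distribˡ-∪)
open import Data.Fin.Subset.Induction using (Acc; acc; ⊂-wellFounded)
open import Data.Vec using (Vec; []; _∷_; lookup; tabulate; zipWith; map)
open import Data.Vec.Properties
  using (∷-injective; lookup-map; lookup-replicate; lookup-zipWith; lookup∘tabulate; tabulate∘lookup; tabulate-cong;
         []=⇒lookup; lookup⇒[]=)
open import Data.List using (List; []; _∷_; _++_; length; filter; cartesianProduct; cartesianProductWith)
  renaming (map to mapˡ)
import Data.List.Properties as List
open import Data.List.Membership.Propositional using () renaming (_∈_ to _∈ˡ_)
open import Data.List.Membership.Propositional.Properties
  using (∈-map⁺; ∈-map⁻; ∈-filter⁺; ∈-filter⁻; ∈-cartesianProduct⁺; ∈-cartesianProduct⁻; ∈-cartesianProductWith⁺)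
open import Data.List.Relation.Unary.Any using (here; there)
open import Data.List.Relation.Unary.All as All using (All; []; _∷_)
import Data.List.Relation.Unary.All.Properties as All
open import Data.List.Relation.Unary.AllPairs using (AllPairs; []; _∷_)
import Data.List.Relation.Unary.AllPairs.Properties as AllPairs
open import Data.List.Relation.Unary.Unique.Propositional using (Unique)
import Data.List.Relation.Unary.Unique.Propositional.Properties as Unique
open import Data.Product using (_,_; proj₁; proj₂; uncurry)
open import Data.Sum using (inj₁; inj₂)
open import Function using (case_of_)
open import Function.Bundles using (_⇔_; mk⇔; Equivalence)
open import Function.Construct.Composition using (_⇔-∘_)
open import Relation.Binary.PropositionalEquality
  using (refl; sym; trans; cong; cong₂; subst; subst₂; module ≡-Reasoning)
open import Relation.Nullary using (¬_; Dec; yes; no; does; contradiction)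
open import Relation.Nullary.Decidable using (_×-dec_; _→-dec_; map′; dec-true; dec-false)
open import Relation.Unary using (Decidable)
open import Data.Integer.Properties using (_≤?_)

toℤ : Bool → ℤ
toℤ false = + 0
toℤ true  = + 1

toℤ-injective : ∀ {a b} → toℤ a ≡ toℤ b → a ≡ b
toℤ-injective {false} {false} _ = refl
toℤ-injective {true}  {true}  _ = refl

toℤ-∧-not : ∀ a b → (b ≡ true → a ≡ true) → toℤ (a ∧ not b) ≡ toℤ a - toℤ b
toℤ-∧-not false false _ = refl
toℤ-∧-not true  false _ = refl
toℤ-∧-not true  true  _ = refl
toℤ-∧-not false true  b⇒a = contradiction (b⇒a refl) λ ()

xor-≢-true : ∀ a b → ¬ (a xor b ≡ true) → a ≡ b
xor-≢-true false false _ = refl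
xor-≢-true true  true  _ = refl
xor-≢-true false true  ¬a⊕b = contradiction refl ¬a⊕b
xor-≢-true true  false ¬a⊕b = contradiction refl ¬a⊕b

does⇒ : ∀ {A : Set} (a? : Dec A) → does a? ≡ true → A
does⇒ (yes a) _ = a

i-j-[k-l]≡i-k-[j-l] : ∀ i j k l → (i - j) - (k - l) ≡ (i - k) - (j - l)
i-j-[k-l]≡i-k-[j-l] = solve-∀

i-j+[k-l]≡i+k-[j+l] : ∀ i j k l → (i - j) +ℤ (k - l) ≡ (i +ℤ k) - (j +ℤ l)
i-j+[k-l]≡i+k-[j+l] = solve-∀

i≡i-j+j : ∀ i j → i ≡ (i - j) +ℤ j
i≡i-j+j = solve-∀

i≡i+j-j : ∀ i j → i ≡ (i +ℤ j) - j
i≡i+j-j = solve-∀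

-- Membership of the tail and head of an edge in T and in X, when no edge enters T
-- and every edge crossing X crosses T: the edge leaves T, or it crosses neither.
data Shape : Bool → Bool → Bool → Bool → Set where
  leaving : ∀ b₁ b₂ → Shape true false b₁ b₂
  within  : ∀ a b → Shape a a b b

shape : ∀ {a₁ a₂ b₁ b₂} → (a₂ ≡ true → a₁ ≡ true) → (b₁ xor b₂ ≡ true → a₁ xor a₂ ≡ true) →
        Shape a₁ a₂ b₁ b₂
shape {true}  {false} _ _ = leaving _ _
shape {false} {true}  noIn _ = contradiction (noIn refl) λ ()
shape {true}  {true}  {b₁} {b₂} _ sub with xor-≢-true b₁ b₂ (λ p → contradiction (sub p) λ ())
... | refl = within true b₁
shape {false} {false} {b₁} {b₂} _ sub with xor-≢-true b₁ b₂ (λ p → contradiction (sub p) λ ())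
... | refl = within false b₁

shape-not : ∀ {a₁ a₂ b₁ b₂} → Shape a₁ a₂ b₁ b₂ → Shape a₁ a₂ (not b₁) (not b₂)
shape-not (leaving b₁ b₂) = leaving (not b₁) (not b₂)
shape-not (within a b)    = within a (not b)

shape-∧-xor : ∀ {a₁ a₂ b₁ b₂} → Shape a₁ a₂ b₁ b₂ → (a₁ ∧ b₁) xor (a₂ ∧ b₂) ≡ (a₁ xor a₂) ∧ b₁
shape-∧-xor (leaving b₁ _) = xor-identityʳ b₁
shape-∧-xor (within a b)   = trans (xor-same (a ∧ b)) (cong (_∧ b) (sym (xor-same a)))

shape-∨-xor : ∀ {a₁ a₂ b₁ b₂} → Shape a₁ a₂ b₁ b₂ → (a₁ ∨ b₁) xor (a₂ ∨ b₂) ≡ (a₁ xor a₂) ∧ not b₂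
shape-∨-xor (leaving _ _) = refl
shape-∨-xor (within a b)  = trans (xor-same (a ∨ b)) (cong (_∧ not b) (sym (xor-same a)))

shape-∧-noIn : ∀ {a₁ a₂ b₁ b₂} → Shape a₁ a₂ b₁ b₂ → a₂ ∧ b₂ ≡ true → a₁ ∧ b₁ ≡ true
shape-∧-noIn (leaving _ _) ()
shape-∧-noIn (within _ _)  p = p

shape-∨-noIn : ∀ {a₁ a₂ b₁ b₂} → Shape a₁ a₂ b₁ b₂ → a₂ ∨ b₂ ≡ true → a₁ ∨ b₁ ≡ true
shape-∨-noIn (leaving _ _) _ = refl
shape-∨-noIn (within _ _)  p = p

shape-constant : ∀ {a₁ a₂ b₁ b₂ β₁ β₂} → Shape a₁ a₂ b₁ b₂ →
                 (a₁ xor a₂ ≡ true → b₁ ≡ β₁ × b₂ ≡ β₂) → b₁ xor b₂ ≡ (a₁ xor a₂) ∧ (β₁ xor β₂)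
shape-constant (leaving _ _) const with const refl
... | refl , refl = refl
shape-constant (within a b) _ = trans (xor-same b) (cong (_∧ _) (sym (xor-same a)))

-- Finite subsets

lookup-ext : ∀ {A : Set} {n} {u v : Vec A n} → (∀ i → lookup u i ≡ lookup v i) → u ≡ v
lookup-ext {u = u} {v} u≗v = trans (sym (tabulate∘lookup u)) (trans (tabulate-cong u≗v) (tabulate∘lookup v))

lookup-─ : ∀ {n} (p q : Subset n) i → lookup (p ─ q) i ≡ lookup p i ∧ not (lookup q i)
lookup-─ (x ∷ p) (inside  ∷ q) zero    = sym (∧-zeroʳ x)
lookup-─ (x ∷ p) (outside ∷ q) zero    = sym (∧-identityʳ x)
lookup-─ (x ∷ p) (_       ∷ q) (suc i) = lookup-─ p q i

module _ {n : ℕ} where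

  ∈⇒lookup : ∀ {p : Subset n} {i} → i ∈ p → lookup p i ≡ true
  ∈⇒lookup = []=⇒lookup

  lookup⇒∈ : ∀ {p : Subset n} {i} → lookup p i ≡ true → i ∈ p
  lookup⇒∈ {p} {i} = lookup⇒[]= i p

  disjoint⁺ : {p q : Subset n} → (∀ i → lookup p i ∧ lookup q i ≡ false) → Disjoint p q
  disjoint⁺ {p} {q} h = lookup-ext λ i →
    trans (lookup-zipWith _∧_ i p q) (trans (h i) (sym (lookup-replicate i false)))

  disjoint⁻ : {p q : Subset n} → Disjoint p q → ∀ i → lookup p i ∧ lookup q i ≡ false
  disjoint⁻ {p} {q} d i =
    trans (sym (lookup-zipWith _∧_ i p q)) (trans (cong (λ r → lookup r i) d) (lookup-replicate i false))

  disjoint-∉ : {p q : Subset n} → Disjoint p q → ∀ {x} → x ∈ p → x ∉ q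
  disjoint-∉ d x∈p x∈q = ∉⊥ (subst (_ ∈_) d (x∈p∩q⁺ (x∈p , x∈q)))

  disjoint-∈⁺ : {p q : Subset n} → (∀ {x} → x ∈ p → x ∉ q) → Disjoint p q
  disjoint-∈⁺ {p} {q} h = Empty-unique λ (x , x∈p∩q) → uncurry h (x∈p∩q⁻ p q x∈p∩q)

  disjoint-mono : {p p′ q q′ : Subset n} → p ⊆ p′ → q ⊆ q′ → Disjoint p′ q′ → Disjoint p q
  disjoint-mono p⊆p′ q⊆q′ d = disjoint-∈⁺ λ x∈p x∈q → disjoint-∉ d (p⊆p′ x∈p) (q⊆q′ x∈q)

  disjoint-⋃ : {p : Subset n} {qs : List (Subset n)} → All (Disjoint p) qs → Disjoint p (⋃ qs)
  disjoint-⋃ {p} [] = ∩-zeroʳ p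
  disjoint-⋃ {p} {q ∷ qs} (d ∷ ds) = begin
    p ∩ (q ∪ ⋃ qs)        ≡⟨ ∩-distribˡ-∪ p q (⋃ qs) ⟩
    p ∩ q ∪ p ∩ ⋃ qs      ≡⟨ cong₂ _∪_ d (disjoint-⋃ ds) ⟩
    ∅ ∪ ∅                 ≡⟨ ∪-identityˡ ∅ ⟩
    ∅                     ∎
    where open ≡-Reasoning

  ⊆-∪-disjoint : {p q r : Subset n} → p ⊆ q ∪ r → Disjoint p r → p ⊆ q
  ⊆-∪-disjoint {q = q} {r} p⊆q∪r d x∈p with x∈p∪q⁻ q r (p⊆q∪r x∈p)
  ... | inj₁ x∈q = x∈q
  ... | inj₂ x∈r = contradiction x∈r (disjoint-∉ d x∈p)

  ⊆∧⊄⇒≡ : {p q : Subset n} → p ⊆ q → ¬ p ⊂ q → p ≡ q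
  ⊆∧⊄⇒≡ {p} p⊆q p⊄q = ⊆-antisym p⊆q λ {x} x∈q → case x ∈? p of λ where
    (yes x∈p) → x∈p
    (no  x∉p) → contradiction ((λ {_} → p⊆q) , x , x∈q , x∉p) p⊄q

  ∩-∪-∩∁ : (p q : Subset n) → p ∩ q ∪ p ∩ ∁ q ≡ p
  ∩-∪-∩∁ p q = begin
    p ∩ q ∪ p ∩ ∁ q   ≡⟨ sym (∩-distribˡ-∪ p q (∁ q)) ⟩
    p ∩ (q ∪ ∁ q)     ≡⟨ cong (p ∩_) (p∪∁p≡⊤ q) ⟩
    p ∩ _             ≡⟨ ∩-identityʳ p ⟩
    p                 ∎
    where open ≡-Reasoning

  disjoint-∩-∩∁ : (p q : Subset n) → Disjoint (p ∩ q) (p ∩ ∁ q)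
  disjoint-∩-∩∁ p q = disjoint-∈⁺ λ x∈p∩q x∈p∩∁q →
    x∈∁p⇒x∉p (proj₂ (x∈p∩q⁻ p (∁ q) x∈p∩∁q)) (proj₂ (x∈p∩q⁻ p q x∈p∩q))

  ∪─-cancel : {p q : Subset n} → Disjoint p q → (p ∪ q) ─ p ≡ q
  ∪─-cancel {p} {q} d = lookup-ext λ i →
    trans (lookup-─ (p ∪ q) p i) (trans (cong (_∧ not (lookup p i)) (lookup-zipWith _∨_ i p q))
      (cancel (lookup p i) (lookup q i) (disjoint⁻ d i)))
    where
    cancel : ∀ a b → a ∧ b ≡ false → (a ∨ b) ∧ not a ≡ b
    cancel false b _ = ∧-identityʳ b
    cancel true false _ = refl

  ∪─-restore : {p q : Subset n} → p ⊆ q → p ∪ (q ─ p) ≡ q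
  ∪─-restore {p} {q} p⊆q = lookup-ext λ i →
    trans (lookup-zipWith _∨_ i p (q ─ p)) (trans (cong (lookup p i ∨_) (lookup-─ q p i))
      (restore (lookup p i) (lookup q i) λ pᵢ → ∈⇒lookup (p⊆q (lookup⇒∈ pᵢ))))
    where
    restore : ∀ a b → (a ≡ true → b ≡ true) → a ∨ (b ∧ not a) ≡ b
    restore false b _   = ∧-identityʳ b
    restore true  b a⇒b = sym (a⇒b refl)

  disjoint-─ : (p q : Subset n) → Disjoint p (q ─ p)
  disjoint-─ p q = disjoint⁺ λ i → trans (cong (lookup p i ∧_) (lookup-─ q p i)) (excluded (lookup p i) (lookup q i))
    where
    excluded : ∀ a b → a ∧ (b ∧ not a) ≡ false
    excluded false b = refl
    excluded true  b = ∧-zeroʳ b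

disjoint-sym : ∀ {n} {p q : Subset n} → Disjoint p q → Disjoint q p
disjoint-sym d = disjoint-∈⁺ λ x∈q x∈p → disjoint-∉ d x∈p x∈q

∪-injective-disjoint : ∀ {n} {p p′ q q′ : Subset n} → Disjoint p q′ → Disjoint p′ q →
                       p ∪ q ≡ p′ ∪ q′ → p ≡ p′ × q ≡ q′
∪-injective-disjoint {p = p} {p′} {q} {q′} pq′ p′q eq =
  ⊆-antisym (⊆-∪-disjoint (λ x∈p → subst (_ ∈_) eq (p⊆p∪q q x∈p)) pq′)
            (⊆-∪-disjoint (λ x∈p′ → subst (_ ∈_) (sym eq) (p⊆p∪q q′ x∈p′)) p′q) ,
  ⊆-antisym (⊆-∪-disjoint (λ x∈q → subst (_ ∈_) (trans eq (∪-comm p′ q′)) (q⊆p∪q p q x∈q)) (disjoint-sym p′q))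
            (⊆-∪-disjoint (λ x∈q′ → subst (_ ∈_) (trans (sym eq) (∪-comm p q)) (q⊆p∪q p′ q′ x∈q′)) (disjoint-sym pq′))

⋃-++ : ∀ {n} (ps qs : List (Subset n)) → ⋃ (ps ++ qs) ≡ ⋃ ps ∪ ⋃ qs
⋃-++ []       qs = sym (∪-identityˡ (⋃ qs))
⋃-++ (p ∷ ps) qs = trans (cong (p ∪_) (⋃-++ ps qs)) (sym (∪-assoc p (⋃ ps) (⋃ qs)))

disjoint-⋃⁻ : ∀ {n} {p : Subset n} qs → Disjoint p (⋃ qs) → All (Disjoint p) qs
disjoint-⋃⁻ []       _ = []
disjoint-⋃⁻ (q ∷ qs) d =
  disjoint-mono ⊆-refl (p⊆p∪q (⋃ qs)) d ∷ disjoint-⋃⁻ qs (disjoint-mono ⊆-refl (q⊆p∪q q (⋃ qs)) d)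

⋃-disjoint-⋃⁻ : ∀ {n} (ps qs : List (Subset n)) → Disjoint (⋃ ps) (⋃ qs) → All (λ p → All (Disjoint p) qs) ps
⋃-disjoint-⋃⁻ []       qs _ = []
⋃-disjoint-⋃⁻ (p ∷ ps) qs d = disjoint-⋃⁻ qs (disjoint-mono (p⊆p∪q (⋃ ps)) ⊆-refl d)
                             ∷ ⋃-disjoint-⋃⁻ ps qs (disjoint-mono (q⊆p∪q p (⋃ ps)) ⊆-refl d)

∩-⊂ : ∀ {n} {p q : Subset n} → Nonempty (p ∩ ∁ q) → p ∩ q ⊂ p
∩-⊂ {p = p} {q} (x , x∈p∩∁q) =
  p∩q⊆p p q , x , proj₁ (x∈p∩q⁻ p (∁ q) x∈p∩∁q) , λ x∈p∩q → disjoint-∉ (disjoint-∩-∩∁ p q) x∈p∩q x∈p∩∁q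

∩∁-⊂ : ∀ {n} {p q : Subset n} → Nonempty (p ∩ q) → p ∩ ∁ q ⊂ p
∩∁-⊂ {p = p} {q} (x , x∈p∩q) =
  p∩q⊆p p (∁ q) , x , proj₁ (x∈p∩q⁻ p q x∈p∩q) , disjoint-∉ (disjoint-∩-∩∁ p q) x∈p∩q

_⊕_ : ∀ {n} → Subset n → Subset n → Subset n
p ⊕ q = zipWith _xor_ p q

indicator : ∀ {n} → Subset n → Vec ℤ n
indicator = map toℤ

indicator-bounded : ∀ {n} (p : Subset n) → Bounded 1 (indicator p)
indicator-bounded p i = subst (λ z → 0ℤ ≤ z × z ≤ + 1) (sym (lookup-map i toℤ p)) (bits (lookup p i))
  where
  bits : ∀ b → 0ℤ ≤ toℤ b × toℤ b ≤ + 1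
  bits false = +≤+ z≤n , +≤+ z≤n
  bits true  = +≤+ z≤n , +≤+ (s≤s z≤n)

indicator-injective : ∀ {n} {p q : Subset n} → indicator p ≡ indicator q → p ≡ q
indicator-injective {p = p} {q} eq = lookup-ext λ i → toℤ-injective
  (trans (sym (lookup-map i toℤ p)) (trans (cong (λ v → lookup v i) eq) (lookup-map i toℤ q)))

support : ∀ {n} → Vec ℤ n → Subset n
support = map λ z → does (z ℤ.≟ + 1)

indicator-support : ∀ {n} {f : Vec ℤ n} → Bounded 1 f → indicator (support f) ≡ f
indicator-support {f = f} bounded = lookup-ext λ i →
  trans (lookup-map i toℤ (support f)) (trans (cong toℤ (lookup-map i _ f)) (bit (lookup f i) (bounded i)))
  where
  bit : ∀ z → 0ℤ ≤ z × z ≤ + 1 → toℤ (does (z ℤ.≟ + 1)) ≡ z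
  bit (+ 0)           _ = refl
  bit (+ 1)           _ = refl
  bit (+ suc (suc _)) (_ , +≤+ (s≤s ()))
  bit -[1+ _ ]        (() , _)

allSubsets : ∀ n → List (Subset n)
allSubsets zero    = [] ∷ []
allSubsets (suc n) = cartesianProductWith _∷_ (true ∷ false ∷ []) (allSubsets n)

∈-allSubsets : ∀ {n} (p : Subset n) → p ∈ˡ allSubsets n
∈-allSubsets []      = here refl
∈-allSubsets (b ∷ p) = ∈-cartesianProductWith⁺ _∷_ (∈-bools b) (∈-allSubsets p)
  where
  ∈-bools : ∀ b → b ∈ˡ true ∷ false ∷ []
  ∈-bools true  = here refl
  ∈-bools false = there (here refl)

allSubsets-unique : ∀ n → Unique (allSubsets n)
allSubsets-unique zero    = [] ∷ []
allSubsets-unique (suc n) =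
  Unique.cartesianProductWith⁺ _∷_ ∷-injective (((λ ()) ∷ []) ∷ [] ∷ []) (allSubsets-unique n)

length-cartesianProduct : ∀ {A B : Set} (xs : List A) (ys : List B) →
                          length (cartesianProduct xs ys) ≡ length xs * length ys
length-cartesianProduct []       ys = refl
length-cartesianProduct (x ∷ xs) ys = trans (List.length-++ (mapˡ (x ,_) ys))
  (cong₂ ℕ._+_ (List.length-map (x ,_) ys) (length-cartesianProduct xs ys))

hasCount-map : ∀ {A B : Set} {P : B → Set} (f : A → B) {xs : List A} → Unique xs →
               (∀ {x y} → x ∈ˡ xs → y ∈ˡ xs → f x ≡ f y → x ≡ y) →
               (∀ y → y ∈ˡ mapˡ f xs ⇔ P y) → HasCount P (length xs)
hasCount-map f {xs} unique injective members =
  mapˡ f xs , List.length-map f xs , map⁺ unique injective , members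
  where
  map⁺ : ∀ {xs} → Unique xs → (∀ {x y} → x ∈ˡ xs → y ∈ˡ xs → f x ≡ f y → x ≡ y) → Unique (mapˡ f xs)
  map⁺ []                 _   = []
  map⁺ (x∉ ∷ u) inj =
    All.map⁺ (All.tabulate λ y∈ fx≡fy → All.lookup x∉ y∈ (inj (here refl) (there y∈) fx≡fy))
    ∷ map⁺ u (λ x∈ y∈ → inj (there x∈) (there y∈))

∈-filter-allSubsets : ∀ {n} {P : Subset n → Set} (P? : Decidable P) {p} → p ∈ˡ filter P? (allSubsets n) ⇔ P p
∈-filter-allSubsets {n} P? = mk⇔ (λ p∈ → proj₂ (∈-filter⁻ P? {xs = allSubsets n} p∈)) (∈-filter⁺ P? (∈-allSubsets _))

∈-map-involutive : ∀ {A : Set} {f : A → A} → (∀ x → f (f x) ≡ x) → ∀ {xs y} → y ∈ˡ mapˡ f xs ⇔ f y ∈ˡ xs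
∈-map-involutive {f = f} f∘f≗id {y = y} = mk⇔
  (λ y∈ → let (x , x∈ , y≡fx) = ∈-map⁻ f y∈ in subst (_∈ˡ _) (sym (trans (cong f y≡fx) (f∘f≗id x))) x∈)
  (λ fy∈ → subst (_∈ˡ _) (f∘f≗id y) (∈-map⁺ f fy∈))

sumFin≡0⇒≡0 : ∀ {k} (f : Fin k → ℕ) → sumFin f ≡ 0 → ∀ i → f i ≡ 0
sumFin≡0⇒≡0 f Σ≡0 zero    = ℕ.m+n≡0⇒m≡0 (f zero) Σ≡0
sumFin≡0⇒≡0 f Σ≡0 (suc i) = sumFin≡0⇒≡0 (λ j → f (suc j)) (ℕ.m+n≡0⇒n≡0 (f zero) Σ≡0) i

sumFinℤ-+ : ∀ {k} (f : Fin k → ℕ) → sumFinℤ (λ i → + f i) ≡ + sumFin f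
sumFinℤ-+ {zero}  f = refl
sumFinℤ-+ {suc k} f = trans (cong (+ f zero +ℤ_) (sumFinℤ-+ (λ i → f (suc i)))) (sym (ℤ.pos-+ (f zero) _))

sumFinℤ-cong : ∀ {k} {f g : Fin k → ℤ} → (∀ i → f i ≡ g i) → sumFinℤ f ≡ sumFinℤ g
sumFinℤ-cong {zero}  _   = refl
sumFinℤ-cong {suc k} f≗g = cong₂ _+ℤ_ (f≗g zero) (sumFinℤ-cong (λ i → f≗g (suc i)))

sumFinℤ≡∑ : ∀ {k} (f : Fin k → ℤ) → sumFinℤ f ≡ ∑[ i < k ] f i
sumFinℤ≡∑ {zero}  f = refl
sumFinℤ≡∑ {suc k} f = cong (f zero +ℤ_) (sumFinℤ≡∑ (λ i → f (suc i)))

∑-δ : ∀ {k} (x : Fin k) (a : Fin k → ℤ) → ∑[ v < k ] (if does (x ≟ v) then a v else 0ℤ) ≡ a x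
∑-δ {suc k} zero a = trans (cong (a zero +ℤ_) (sum-replicate-zero k)) (ℤ.+-identityʳ (a zero))
∑-δ {suc k} (suc x) a = trans (ℤ.+-identityˡ _) (∑-δ x (λ v → a (suc v)))

-- Cuts

module _ (G : Graph) where

  lookup-cut : ∀ S e → lookup (cut G S) e ≡ lookup S (proj₁ (ends G e)) xor lookup S (proj₂ (ends G e))
  lookup-cut S e = lookup∘tabulate _ e

  cut-∅ : cut G ∅ ≡ ∅
  cut-∅ = lookup-ext λ e → let (u , v) = ends G e in
    trans (lookup-cut ∅ e) (trans (cong₂ _xor_ (lookup-replicate u false) (lookup-replicate v false))
                                  (sym (lookup-replicate e false)))

  cut-⊕ : ∀ {S S′} → Disjoint (cut G S) (cut G S′) → cut G (S ⊕ S′) ≡ cut G S ∪ cut G S′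
  cut-⊕ {S} {S′} d = lookup-ext λ e → let (u , v) = ends G e in begin
    lookup (cut G (S ⊕ S′)) e
      ≡⟨ lookup-cut (S ⊕ S′) e ⟩
    lookup (S ⊕ S′) u xor lookup (S ⊕ S′) v
      ≡⟨ cong₂ _xor_ (lookup-zipWith _xor_ u S S′) (lookup-zipWith _xor_ v S S′) ⟩
    (lookup S u xor lookup S′ u) xor (lookup S v xor lookup S′ v)
      ≡⟨ interchange (lookup S u) (lookup S′ u) (lookup S v) (lookup S′ v) ⟩
    (lookup S u xor lookup S v) xor (lookup S′ u xor lookup S′ v)
      ≡⟨ cong₂ _xor_ (lookup-cut S e) (lookup-cut S′ e) ⟨
    lookup (cut G S) e xor lookup (cut G S′) e
      ≡⟨ xor-disjoint (lookup (cut G S) e) (lookup (cut G S′) e) (disjoint⁻ d e) ⟩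
    lookup (cut G S) e ∨ lookup (cut G S′) e
      ≡⟨ lookup-zipWith _∨_ e (cut G S) (cut G S′) ⟨
    lookup (cut G S ∪ cut G S′) e
      ∎
    where
    open ≡-Reasoning
    xor-disjoint : ∀ a b → a ∧ b ≡ false → a xor b ≡ a ∨ b
    xor-disjoint false b _ = refl
    xor-disjoint true false _ = refl

module _ (G : Graph) (ρ : Orientation G) where

  tail head : Fin (nE G) → Fin (nV G)
  tail = tl G ρ
  head = hd G ρ

  cut-tail-head : ∀ S e → lookup (cut G S) e ≡ lookup S (tail e) xor lookup S (head e)
  cut-tail-head S e = trans (lookup-cut G S e) (reorient (lookup ρ e))
    where
    u = proj₁ (ends G e)
    v = proj₂ (ends G e)
    reorient : ∀ b → lookup S u xor lookup S v ≡ lookup S (if b then u else v) xor lookup S (if b then v else u)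
    reorient true  = refl
    reorient false = xor-comm (lookup S u) (lookup S v)

  -- cut G T is directed (all its edges leave T) iff no edge enters T.
  NoEdgeEnters : VertexSet G → Set
  NoEdgeEnters T = ∀ e → lookup T (head e) ≡ true → lookup T (tail e) ≡ true

  noEdgeEnters? : ∀ T → Dec (NoEdgeEnters T)
  noEdgeEnters? T = all? λ e → (lookup T (head e) ≟ᵇ true) →-dec (lookup T (tail e) ≟ᵇ true)

  noEdgeEnters⇒leaves : ∀ {T} → NoEdgeEnters T → ∀ e → e ∈ cut G T → tail e ∈ T × lookup T (head e) ≡ false
  noEdgeEnters⇒leaves {T} noIn e e∈cut =
    let (t∈T , h∉T) = leaves (noIn e) (trans (sym (cut-tail-head T e)) (∈⇒lookup e∈cut)) in lookup⇒∈ t∈T , h∉T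
    where
    leaves : ∀ {a₁ a₂} → (a₂ ≡ true → a₁ ≡ true) → a₁ xor a₂ ≡ true → a₁ ≡ true × a₂ ≡ false
    leaves {true}  {false} _ _ = refl , refl
    leaves {false} {true}  a₂⇒a₁ _ = contradiction (a₂⇒a₁ refl) λ ()

  leaves⇒noEdgeEnters : ∀ {T} → (∀ e → e ∈ cut G T → tail e ∈ T × lookup T (head e) ≡ false) → NoEdgeEnters T
  leaves⇒noEdgeEnters {T} leave e = noEnter λ crosses →
    let (t∈T , h∉T) = leave e (lookup⇒∈ (trans (cut-tail-head T e) crosses)) in ∈⇒lookup t∈T , h∉T
    where
    noEnter : ∀ {a₁ a₂} → (a₁ xor a₂ ≡ true → a₁ ≡ true × a₂ ≡ false) → a₂ ≡ true → a₁ ≡ true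
    noEnter {true}          _     _ = refl
    noEnter {false} {true}  leave _ = proj₁ (leave refl)

  toℤ-cut : ∀ {T} → NoEdgeEnters T → ∀ e →
            toℤ (lookup (cut G T) e) ≡ toℤ (lookup T (tail e)) - toℤ (lookup T (head e))
  toℤ-cut {T} noIn e = trans (cong toℤ (cut-tail-head T e)) (toℤ-xor (noIn e))
    where
    toℤ-xor : ∀ {a₁ a₂} → (a₂ ≡ true → a₁ ≡ true) → toℤ (a₁ xor a₂) ≡ toℤ a₁ - toℤ a₂
    toℤ-xor {false} {false} _ = refl
    toℤ-xor {true}  {false} _ = refl
    toℤ-xor {true}  {true}  _ = refl
    toℤ-xor {false} {true}  a₂⇒a₁ = contradiction (a₂⇒a₁ refl) λ ()

  record Compatible (T X : VertexSet G) : Set where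
    constructor compatibleAt
    field
      shapeAt : ∀ e → Shape (lookup T (tail e)) (lookup T (head e)) (lookup X (tail e)) (lookup X (head e))
  open Compatible

  compatible : ∀ {T X} → NoEdgeEnters T → cut G X ⊆ cut G T → Compatible T X
  compatible {T} {X} noIn X⊆T = compatibleAt λ e → shape (noIn e) λ X-crosses →
    trans (sym (cut-tail-head T e)) (∈⇒lookup (X⊆T (lookup⇒∈ (trans (cut-tail-head X e) X-crosses))))

  compatible-∁ : ∀ {T X} → Compatible T X → Compatible T (∁ X)
  compatible-∁ {X = X} c = compatibleAt λ e →
    subst₂ (Shape _ _) (sym (lookup-map (tail e) not X)) (sym (lookup-map (head e) not X)) (shape-not (shapeAt c e))

  preimage : (Fin (nE G) → Fin (nV G)) → VertexSet G → EdgeSet G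
  preimage x X = tabulate λ e → lookup X (x e)

  preimage-∁ : ∀ x X → preimage x (∁ X) ≡ ∁ (preimage x X)
  preimage-∁ x X = lookup-ext λ e →
    trans (lookup∘tabulate _ e) (trans (lookup-map (x e) not X)
      (trans (cong not (sym (lookup∘tabulate _ e))) (sym (lookup-map e not (preimage x X)))))

  module _ {T X : VertexSet G} (c : Compatible T X) where
    open ≡-Reasoning

    cut-∩ : cut G (T ∩ X) ≡ cut G T ∩ preimage tail X
    cut-∩ = lookup-ext λ e → begin
      lookup (cut G (T ∩ X)) e
        ≡⟨ cut-tail-head (T ∩ X) e ⟩
      lookup (T ∩ X) (tail e) xor lookup (T ∩ X) (head e)
        ≡⟨ cong₂ _xor_ (lookup-zipWith _∧_ (tail e) T X) (lookup-zipWith _∧_ (head e) T X) ⟩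
      (lookup T (tail e) ∧ lookup X (tail e)) xor (lookup T (head e) ∧ lookup X (head e))
        ≡⟨ shape-∧-xor (shapeAt c e) ⟩
      (lookup T (tail e) xor lookup T (head e)) ∧ lookup X (tail e)
        ≡⟨ cong₂ _∧_ (cut-tail-head T e) (lookup∘tabulate _ e) ⟨
      lookup (cut G T) e ∧ lookup (preimage tail X) e
        ≡⟨ lookup-zipWith _∧_ e (cut G T) (preimage tail X) ⟨
      lookup (cut G T ∩ preimage tail X) e
        ∎

    cut-∪ : cut G (T ∪ X) ≡ cut G T ∩ ∁ (preimage head X)
    cut-∪ = lookup-ext λ e → begin
      lookup (cut G (T ∪ X)) e
        ≡⟨ cut-tail-head (T ∪ X) e ⟩
      lookup (T ∪ X) (tail e) xor lookup (T ∪ X) (head e)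
        ≡⟨ cong₂ _xor_ (lookup-zipWith _∨_ (tail e) T X) (lookup-zipWith _∨_ (head e) T X) ⟩
      (lookup T (tail e) ∨ lookup X (tail e)) xor (lookup T (head e) ∨ lookup X (head e))
        ≡⟨ shape-∨-xor (shapeAt c e) ⟩
      (lookup T (tail e) xor lookup T (head e)) ∧ not (lookup X (head e))
        ≡⟨ cong₂ _∧_ (cut-tail-head T e) (trans (lookup-map e not (preimage head X)) (cong not (lookup∘tabulate _ e))) ⟨
      lookup (cut G T) e ∧ lookup (∁ (preimage head X)) e
        ≡⟨ lookup-zipWith _∧_ e (cut G T) (∁ (preimage head X)) ⟨
      lookup (cut G T ∩ ∁ (preimage head X)) e
        ∎

    noEdgeEnters-∩ : NoEdgeEnters (T ∩ X)
    noEdgeEnters-∩ e h∈ = trans (lookup-zipWith _∧_ (tail e) T X)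
      (shape-∧-noIn (shapeAt c e) (trans (sym (lookup-zipWith _∧_ (head e) T X)) h∈))

    noEdgeEnters-∪ : NoEdgeEnters (T ∪ X)
    noEdgeEnters-∪ e h∈ = trans (lookup-zipWith _∨_ (tail e) T X)
      (shape-∨-noIn (shapeAt c e) (trans (sym (lookup-zipWith _∨_ (head e) T X)) h∈))

  record DirectedSplit (T : VertexSet G) : Set where
    field
      left right      : VertexSet G
      separator       : EdgeSet G
      left-noEnter    : NoEdgeEnters left
      right-noEnter   : NoEdgeEnters right
      left-nonempty   : Nonempty (cut G left)
      right-nonempty  : Nonempty (cut G right)
      cut-left        : cut G left ≡ cut G T ∩ separator
      cut-right       : cut G right ≡ cut G T ∩ ∁ separator

    left⊂ : cut G left ⊂ cut G T
    left⊂ = subst (_⊂ cut G T) (sym cut-left) (∩-⊂ (subst Nonempty cut-right right-nonempty))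

    right⊂ : cut G right ⊂ cut G T
    right⊂ = subst (_⊂ cut G T) (sym cut-right) (∩∁-⊂ (subst Nonempty cut-left left-nonempty))

    left-disjoint-right : Disjoint (cut G left) (cut G right)
    left-disjoint-right = subst₂ Disjoint (sym cut-left) (sym cut-right) (disjoint-∩-∩∁ (cut G T) separator)

    left∪right : cut G left ∪ cut G right ≡ cut G T
    left∪right = trans (cong₂ _∪_ cut-left cut-right) (∩-∪-∩∁ (cut G T) separator)

  ∈-cut-∩ : ∀ {T Y} → Compatible T Y → ∀ {e} → e ∈ cut G T → lookup Y (tail e) ≡ true → e ∈ cut G (T ∩ Y)
  ∈-cut-∩ c {e} e∈T Yₜ = subst (e ∈_) (sym (cut-∩ c)) (x∈p∩q⁺ (e∈T , lookup⇒∈ (trans (lookup∘tabulate _ e) Yₜ)))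

  ∈-cut-∪ : ∀ {T Y} → Compatible T Y → ∀ {e} → e ∈ cut G T → lookup Y (head e) ≡ false → e ∈ cut G (T ∪ Y)
  ∈-cut-∪ {Y = Y} c {e} e∈T Yₕ = subst (e ∈_) (sym (cut-∪ c)) (x∈p∩q⁺ (e∈T , lookup⇒∈
    (trans (lookup-map e not (preimage head Y)) (cong not (trans (lookup∘tabulate _ e) Yₕ)))))

  module _ {T X : VertexSet G} (c : Compatible T X) where

    splitByTails : Nonempty (cut G (T ∩ X)) → Nonempty (cut G (T ∩ ∁ X)) → DirectedSplit T
    splitByTails n₁ n₂ = record
      { left = T ∩ X ; right = T ∩ ∁ X ; separator = preimage tail X
      ; left-noEnter = noEdgeEnters-∩ c ; right-noEnter = noEdgeEnters-∩ (compatible-∁ c)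
      ; left-nonempty = n₁ ; right-nonempty = n₂
      ; cut-left = cut-∩ c
      ; cut-right = trans (cut-∩ (compatible-∁ c)) (cong (cut G T ∩_) (preimage-∁ tail X)) }

    splitByHeads : Nonempty (cut G (T ∪ X)) → Nonempty (cut G (T ∪ ∁ X)) → DirectedSplit T
    splitByHeads n₁ n₂ = record
      { left = T ∪ X ; right = T ∪ ∁ X ; separator = ∁ (preimage head X)
      ; left-noEnter = noEdgeEnters-∪ c ; right-noEnter = noEdgeEnters-∪ (compatible-∁ c)
      ; left-nonempty = n₁ ; right-nonempty = n₂
      ; cut-left = cut-∪ c
      ; cut-right = trans (cut-∪ (compatible-∁ c)) (cong (λ Q → cut G T ∩ ∁ Q) (preimage-∁ head X)) }

    tails-constant : ¬ (Nonempty (cut G (T ∩ X)) × Nonempty (cut G (T ∩ ∁ X))) →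
                     ∃ λ β → ∀ e → e ∈ cut G T → lookup X (tail e) ≡ β
    tails-constant ¬both with nonempty? (cut G (T ∩ X))
    ... | no  ¬n₁ = false , λ e e∈T → ¬-not λ Xₜ → ¬n₁ (e , ∈-cut-∩ c e∈T Xₜ)
    ... | yes n₁  = true  , λ e e∈T → ¬-not λ Xₜ → ¬both (n₁ , e ,
                      ∈-cut-∩ (compatible-∁ c) e∈T (trans (lookup-map (tail e) not X) (cong not Xₜ)))

    heads-constant : ¬ (Nonempty (cut G (T ∪ X)) × Nonempty (cut G (T ∪ ∁ X))) →
                     ∃ λ β → ∀ e → e ∈ cut G T → lookup X (head e) ≡ β
    heads-constant ¬both with nonempty? (cut G (T ∪ X))
    ... | no  ¬n₁ = true  , λ e e∈T → ¬-not λ Xₕ → ¬n₁ (e , ∈-cut-∪ c e∈T Xₕ)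
    ... | yes n₁  = false , λ e e∈T → ¬-not λ Xₕ → ¬both (n₁ , e ,
                      ∈-cut-∪ (compatible-∁ c) e∈T (trans (lookup-map (head e) not X) (cong not Xₕ)))

  constantEnds⇒⊄ : ∀ {T T′ β₁ β₂} → Compatible T T′ →
                  (∀ e → e ∈ cut G T → lookup T′ (tail e) ≡ β₁) →
                  (∀ e → e ∈ cut G T → lookup T′ (head e) ≡ β₂) →
                  Nonempty (cut G T′) → ¬ cut G T′ ⊂ cut G T
  constantEnds⇒⊄ {T} {T′} {β₁} {β₂} c tail-const head-const (x , x∈T′) =
    onCut (β₁ xor β₂) λ e → trans (cut-tail-head T′ e)
      (trans (shape-constant (shapeAt c e) (ends-const e)) (cong (_∧ (β₁ xor β₂)) (sym (cut-tail-head T e))))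
    where
    ends-const : ∀ e → lookup T (tail e) xor lookup T (head e) ≡ true →
                 lookup T′ (tail e) ≡ β₁ × lookup T′ (head e) ≡ β₂
    ends-const e crosses = let e∈T = lookup⇒∈ (trans (cut-tail-head T e) crosses) in
      tail-const e e∈T , head-const e e∈T
    onCut : ∀ b → (∀ e → lookup (cut G T′) e ≡ lookup (cut G T) e ∧ b) → ¬ cut G T′ ⊂ cut G T
    onCut true  ≗cut = ⊂-irref (lookup-ext λ e → trans (≗cut e) (∧-identityʳ _))
    onCut false ≗cut _ = contradiction (trans (sym (trans (≗cut x) (∧-zeroʳ _))) (∈⇒lookup x∈T′)) λ ()

  -- Each of the pairs (T ∩ T′, T ∩ ∁ T′) and (T ∪ T′, T ∪ ∁ T′) partitions cut T
  -- into directed cuts.  If both pairs have an empty side, T′ is constant on the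
  -- tails and on the heads of cut T, so cut T′ is ∅ or cut T.
  directedSplit : ∀ {T T′} → NoEdgeEnters T → Nonempty (cut G T′) → cut G T′ ⊂ cut G T → DirectedSplit T
  directedSplit {T} {T′} noIn ne T′⊂T = splitAlong (compatible noIn (proj₁ T′⊂T))
    where
    splitAlong : Compatible T T′ → DirectedSplit T
    splitAlong c with nonempty? (cut G (T ∩ T′)) ×-dec nonempty? (cut G (T ∩ ∁ T′))
                    | nonempty? (cut G (T ∪ T′)) ×-dec nonempty? (cut G (T ∪ ∁ T′))
    ... | yes (n₁ , n₂) | _              = splitByTails c n₁ n₂
    ... | no _          | yes (n₃ , n₄)  = splitByHeads c n₃ n₄
    ... | no ¬tails     | no ¬heads      = contradiction T′⊂T
      (constantEnds⇒⊄ c (proj₂ (tails-constant c ¬tails)) (proj₂ (heads-constant c ¬heads)) ne)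

  BondPartition : EdgeSet G → Set
  BondPartition C = ∃ λ Bs → All (IsDirectedBond G ρ) Bs × AllPairs Disjoint Bs × ⋃ Bs ≡ C

  bondPartition-∪ : ∀ {C C′} → Disjoint C C′ → BondPartition C → BondPartition C′ → BondPartition (C ∪ C′)
  bondPartition-∪ d (Bs , bonds , disj , refl) (Bs′ , bonds′ , disj′ , refl) =
    Bs ++ Bs′ , All.++⁺ bonds bonds′ ,
    AllPairs.++⁺ disj disj′ (⋃-disjoint-⋃⁻ Bs Bs′ d) ,
    ⋃-++ Bs Bs′

  -- A directed cut with a proper nonempty subcut splits; otherwise it is empty or a bond.
  directedCut⇒bondPartition : ∀ {T} → NoEdgeEnters T → BondPartition (cut G T)
  directedCut⇒bondPartition {T} = go T (⊂-wellFounded (cut G T))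
    where
    go : ∀ T → Acc _⊂_ (cut G T) → NoEdgeEnters T → BondPartition (cut G T)
    go T (acc smaller) noIn with anySubset? (λ T′ → nonempty? (cut G T′) ×-dec (cut G T′ ⊂? cut G T))
    ... | yes (T′ , ne , T′⊂T) = subst BondPartition left∪right (bondPartition-∪ left-disjoint-right
            (go left (smaller left⊂) left-noEnter) (go right (smaller right⊂) right-noEnter))
      where open DirectedSplit (directedSplit {T} {T′} noIn ne T′⊂T)
    ... | no noSmaller with nonempty? (cut G T)
    ...   | no  empty = [] , [] , [] , sym (Empty-unique empty)
    ...   | yes ne    = cut G T ∷ [] , bond ∷ [] , [] ∷ [] , ∪-identityʳ (cut G T)
      where
      minimal : ∀ B → IsCut G B → Nonempty B → B ⊆ cut G T → B ≡ cut G T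
      minimal _ (T′ , refl) ne′ T′⊆T = ⊆∧⊄⇒≡ T′⊆T λ T′⊂T → noSmaller (T′ , ne′ , T′⊂T)
      bond : IsDirectedBond G ρ (cut G T)
      bond = ((T , refl) , ne , minimal) , T , refl , noEdgeEnters⇒leaves {T} noIn

  -- The inductive form of a locally directed cut, used to decide it and to build its potential.
  data DirectedCutDecomposition : EdgeSet G → Set where
    []   : DirectedCutDecomposition ∅
    peel : ∀ {C} T → NoEdgeEnters T → Nonempty (cut G T) → cut G T ⊆ C →
           DirectedCutDecomposition (C ─ cut G T) → DirectedCutDecomposition C

  decomposition⇒locallyDirected : ∀ {C} → DirectedCutDecomposition C → IsLocallyDirectedCut G ρ C
  decomposition⇒locallyDirected [] = (∅ , cut-∅ G) , [] , [] , [] , refl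
  decomposition⇒locallyDirected {C} (peel T noIn _ T⊆C rest) with decomposition⇒locallyDirected rest
  ... | (S , cutS≡rest) , partition = subst (IsLocallyDirectedCut G ρ) (∪─-restore T⊆C)
    ((T ⊕ S , trans (cut-⊕ G {T} {S} (subst (Disjoint (cut G T)) (sym cutS≡rest) T∩rest≡∅))
                    (cong (cut G T ∪_) cutS≡rest)) ,
     bondPartition-∪ T∩rest≡∅ (directedCut⇒bondPartition {T} noIn) partition)
    where
    T∩rest≡∅ : Disjoint (cut G T) (C ─ cut G T)
    T∩rest≡∅ = disjoint-─ (cut G T) C

  bonds⇒decomposition : ∀ {Bs} → All (IsDirectedBond G ρ) Bs → AllPairs Disjoint Bs →
                        DirectedCutDecomposition (⋃ Bs)
  bonds⇒decomposition [] [] = []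
  bonds⇒decomposition {_ ∷ Bs} (((_ , ne , _) , S , refl , leaves) ∷ bonds) (d ∷ disj) =
    peel S (leaves⇒noEdgeEnters {S} leaves) ne (p⊆p∪q (⋃ Bs))
      (subst DirectedCutDecomposition (sym (∪─-cancel (disjoint-⋃ d))) (bonds⇒decomposition bonds disj))

  locallyDirected⇒decomposition : ∀ {C} → IsLocallyDirectedCut G ρ C → DirectedCutDecomposition C
  locallyDirected⇒decomposition (_ , _ , bonds , disj , refl) = bonds⇒decomposition bonds disj

  Peel : EdgeSet G → VertexSet G → Set
  Peel C T = NoEdgeEnters T × Nonempty (cut G T) × cut G T ⊆ C × DirectedCutDecomposition (C ─ cut G T)

  firstPeel : ∀ {C} → Nonempty C → DirectedCutDecomposition C → ∃ (Peel C)
  firstPeel (_ , x∈∅) [] = contradiction x∈∅ ∉⊥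
  firstPeel _ (peel T noIn ne T⊆C rest) = T , noIn , ne , T⊆C , rest

  decomposition? : ∀ C → Dec (DirectedCutDecomposition C)
  decomposition? C = go C (⊂-wellFounded C)
    where
    go : ∀ C → Acc _⊂_ C → Dec (DirectedCutDecomposition C)
    go C (acc smaller) with nonempty? C
    ... | no  empty = yes (subst DirectedCutDecomposition (sym (Empty-unique empty)) [])
    ... | yes ne    = map′ (λ (T , noIn , neT , T⊆C , rest) → peel T noIn neT T⊆C rest) (firstPeel ne)
                           (anySubset? peel?)
      where
      peel? : ∀ T → Dec (Peel C T)
      peel? T with noEdgeEnters? T | nonempty? (cut G T) | cut G T ⊆? C
      ... | no ¬noIn | _       | _       = no λ (noIn , _) → ¬noIn noIn
      ... | yes _    | no ¬neT | _       = no λ (_ , neT , _) → ¬neT neT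
      ... | yes _    | yes _   | no ¬T⊆C = no λ (_ , _ , T⊆C , _) → ¬T⊆C T⊆C
      ... | yes noIn | yes neT@(x , x∈T) | yes T⊆C =
        map′ (λ rest → noIn , neT , T⊆C , rest) (λ (_ , _ , _ , rest) → rest)
          (go (C ─ cut G T) (smaller (p∩q≢∅⇒p─q⊂p C (cut G T) (x , x∈p∩q⁺ (T⊆C x∈T , x∈T)))))

  -- Potentials

  Potential : EdgeSet G → (Fin (nV G) → ℤ) → Set
  Potential C h = ∀ e → toℤ (lookup C e) ≡ h (tail e) - h (head e)

  tension⇔potential : ∀ {C} → IsTension G ρ (indicator C) ⇔ ∃ (Potential C)
  tension⇔potential {C} = mk⇔ (λ (h , tension) → h , λ e → trans (sym (lookup-map e toℤ C)) (tension e))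
                              (λ (h , pot) → h , λ e → trans (lookup-map e toℤ C) (pot e))

  module _ {T C} (noIn : NoEdgeEnters T) (T⊆C : cut G T ⊆ C) where
    open ≡-Reasoning

    private
      𝟙T : Fin (nV G) → ℤ
      𝟙T v = toℤ (lookup T v)

      toℤ-─ : ∀ e → toℤ (lookup (C ─ cut G T) e) ≡ toℤ (lookup C e) - toℤ (lookup (cut G T) e)
      toℤ-─ e = trans (cong toℤ (lookup-─ C (cut G T) e))
        (toℤ-∧-not (lookup C e) (lookup (cut G T) e) λ e∈T → ∈⇒lookup (T⊆C (lookup⇒∈ e∈T)))

    potential-─ : ∀ {h} → Potential C h → Potential (C ─ cut G T) (λ v → h v - 𝟙T v)
    potential-─ {h} pot e = begin
      toℤ (lookup (C ─ cut G T) e)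
        ≡⟨ toℤ-─ e ⟩
      toℤ (lookup C e) - toℤ (lookup (cut G T) e)
        ≡⟨ cong₂ _-_ (pot e) (toℤ-cut {T} noIn e) ⟩
      (h (tail e) - h (head e)) - (𝟙T (tail e) - 𝟙T (head e))
        ≡⟨ i-j-[k-l]≡i-k-[j-l] (h (tail e)) (h (head e)) (𝟙T (tail e)) (𝟙T (head e)) ⟩
      (h (tail e) - 𝟙T (tail e)) - (h (head e) - 𝟙T (head e))
        ∎

    potential-∪ : ∀ {h} → Potential (C ─ cut G T) h → Potential C (λ v → h v +ℤ 𝟙T v)
    potential-∪ {h} pot e = begin
      toℤ (lookup C e)
        ≡⟨ i≡i-j+j (toℤ (lookup C e)) (toℤ (lookup (cut G T) e)) ⟩
      (toℤ (lookup C e) - toℤ (lookup (cut G T) e)) +ℤ toℤ (lookup (cut G T) e)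
        ≡⟨ cong₂ _+ℤ_ (trans (sym (toℤ-─ e)) (pot e)) (toℤ-cut {T} noIn e) ⟩
      (h (tail e) - h (head e)) +ℤ (𝟙T (tail e) - 𝟙T (head e))
        ≡⟨ i-j+[k-l]≡i+k-[j+l] (h (tail e)) (h (head e)) (𝟙T (tail e)) (𝟙T (head e)) ⟩
      (h (tail e) +ℤ 𝟙T (tail e)) - (h (head e) +ℤ 𝟙T (head e))
        ∎

  decomposition⇒potential : ∀ {C} → DirectedCutDecomposition C → ∃ (Potential C)
  decomposition⇒potential [] = (λ _ → 0ℤ) , λ e → cong toℤ (lookup-replicate e false)
  decomposition⇒potential (peel T noIn _ T⊆C rest) =
    let (h , pot) = decomposition⇒potential rest in (λ v → h v +ℤ toℤ (lookup T v)) , potential-∪ {T} noIn T⊆C {h} pot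

  atLeast : (Fin (nV G) → ℤ) → ℤ → VertexSet G
  atLeast h m = tabulate λ v → does (m ≤? h v)

  module _ {C h} (pot : Potential C h) where

    tail≡toℤ+head : ∀ e → h (tail e) ≡ toℤ (lookup C e) +ℤ h (head e)
    tail≡toℤ+head e = trans (i≡i-j+j (h (tail e)) (h (head e))) (cong (_+ℤ h (head e)) (sym (pot e)))

    head≤tail : ∀ e → h (head e) ≤ h (tail e)
    head≤tail e = subst (h (head e) ≤_) (sym (tail≡toℤ+head e)) (≤toℤ+ (lookup C e))
      where
      ≤toℤ+ : ∀ b → h (head e) ≤ toℤ b +ℤ h (head e)
      ≤toℤ+ false = ℤ.i≤j+i (h (head e)) (+ 0)
      ≤toℤ+ true  = ℤ.i≤j+i (h (head e)) (+ 1)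

    atLeast-noEdgeEnters : ∀ m → NoEdgeEnters (atLeast h m)
    atLeast-noEdgeEnters m e h∈ = trans (lookup∘tabulate _ (tail e))
      (dec-true (m ≤? h (tail e))
        (ℤ.≤-trans (does⇒ (m ≤? h (head e)) (trans (sym (lookup∘tabulate _ (head e))) h∈)) (head≤tail e)))

    cut-atLeast⊆ : ∀ m → cut G (atLeast h m) ⊆ C
    cut-atLeast⊆ m {e} e∈cut with lookup C e in Cₑ
    ... | true  = lookup⇒∈ Cₑ
    ... | false = contradiction (trans (sym crossing) (∈⇒lookup e∈cut)) λ ()
      where
      T = atLeast h m
      level : h (tail e) ≡ h (head e)
      level = trans (tail≡toℤ+head e) (trans (cong (λ b → toℤ b +ℤ h (head e)) Cₑ) (ℤ.+-identityˡ (h (head e))))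
      crossing : lookup (cut G T) e ≡ false
      crossing = trans (cut-tail-head T e) (trans (cong (_xor lookup T (head e))
        (trans (lookup∘tabulate _ (tail e))
          (trans (cong (λ z → does (m ≤? z)) level) (sym (lookup∘tabulate _ (head e))))))
        (xor-same (lookup T (head e))))

    ∈-cut-atLeast : ∀ {e} → e ∈ C → e ∈ cut G (atLeast h (h (tail e)))
    ∈-cut-atLeast {e} e∈C = lookup⇒∈ (trans (cut-tail-head T e)
      (cong₂ _xor_ (trans (lookup∘tabulate _ (tail e)) (dec-true (m ≤? m) ℤ.≤-refl))
                   (trans (lookup∘tabulate _ (head e)) (dec-false (m ≤? h (head e)) m≰head))))
      where
      m = h (tail e)
      T = atLeast h m
      m≰head : ¬ m ≤ h (head e)
      m≰head m≤ = ℤ.<-irrefl refl (ℤ.suc[i]≤j⇒i<j (subst (_≤ h (head e))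
        (trans (tail≡toℤ+head e) (cong (λ b → toℤ b +ℤ h (head e)) (∈⇒lookup e∈C))) m≤))

  -- The vertices where h is at least h (tail e), for an edge e of C, form a directed
  -- cut inside C through e; removing it lowers the potential by its indicator.
  potential⇒decomposition : ∀ {C h} → Potential C h → DirectedCutDecomposition C
  potential⇒decomposition {C} {h} = go C (⊂-wellFounded C) {h}
    where
    go : ∀ C → Acc _⊂_ C → ∀ {h} → Potential C h → DirectedCutDecomposition C
    go C (acc smaller) {h} pot with nonempty? C
    ... | no  empty = subst DirectedCutDecomposition (sym (Empty-unique empty)) []
    ... | yes (e , e∈C) = peel T noIn (e , e∈T) T⊆C
          (go (C ─ cut G T) (smaller (p∩q≢∅⇒p─q⊂p C (cut G T) (e , x∈p∩q⁺ (e∈C , e∈T))))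
            {λ v → h v - toℤ (lookup T v)} (potential-─ {T} noIn T⊆C {h} pot))
      where
      T = atLeast h (h (tail e))
      noIn = atLeast-noEdgeEnters {C} {h} pot (h (tail e))
      T⊆C = cut-atLeast⊆ {C} {h} pot (h (tail e))
      e∈T = ∈-cut-atLeast {C} {h} pot e∈C

  tension⇔locallyDirected : ∀ {C} → IsTension G ρ (indicator C) ⇔ IsLocallyDirectedCut G ρ C
  tension⇔locallyDirected {C} = mk⇔
    (λ tension → let (h , pot) = Equivalence.to (tension⇔potential {C}) tension in
      decomposition⇒locallyDirected (potential⇒decomposition {C} {h} pot))
    (λ ldc → Equivalence.from (tension⇔potential {C}) (decomposition⇒potential (locallyDirected⇒decomposition ldc)))

  locallyDirected? : Decidable (IsLocallyDirectedCut G ρ)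
  locallyDirected? C = map′ decomposition⇒locallyDirected locallyDirected⇒decomposition (decomposition? C)

  endpointSum : (Fin (nE G) → Fin (nV G)) → Vec ℤ (nE G) → Fin (nV G) → ℤ
  endpointSum x g v = sumFinℤ λ e → if does (x e ≟ v) then lookup g e else 0ℤ

  ∑-by-endpoint : ∀ (x : Fin (nE G) → Fin (nV G)) (h : Fin (nV G) → ℤ) (g : Vec ℤ (nE G)) →
    ∑[ e < nE G ] (h (x e) *ℤ lookup g e) ≡ ∑[ v < nV G ] (h v *ℤ endpointSum x g v)
  ∑-by-endpoint x h g = sym (begin
    ∑[ v < nV G ] (h v *ℤ endpointSum x g v)
      ≡⟨ sum-cong-≗ (λ v → cong (h v *ℤ_) (sumFinℤ≡∑ (λ e → if does (x e ≟ v) then lookup g e else 0ℤ))) ⟩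
    ∑[ v < nV G ] (h v *ℤ ∑[ e < nE G ] (if does (x e ≟ v) then lookup g e else 0ℤ))
      ≡⟨ sum-cong-≗ (λ v → *-distribˡ-sum (h v) (λ e → if does (x e ≟ v) then lookup g e else 0ℤ)) ⟩
    ∑[ v < nV G ] ∑[ e < nE G ] (h v *ℤ (if does (x e ≟ v) then lookup g e else 0ℤ))
      ≡⟨ ∑-comm (λ v e → h v *ℤ (if does (x e ≟ v) then lookup g e else 0ℤ)) ⟩
    ∑[ e < nE G ] ∑[ v < nV G ] (h v *ℤ (if does (x e ≟ v) then lookup g e else 0ℤ))
      ≡⟨ sum-cong-≗ (λ e → sum-cong-≗ (λ v → *-if (h v) (does (x e ≟ v)))) ⟩
    ∑[ e < nE G ] ∑[ v < nV G ] (if does (x e ≟ v) then h v *ℤ lookup g e else 0ℤ)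
      ≡⟨ sum-cong-≗ (λ e → ∑-δ (x e) (λ v → h v *ℤ lookup g e)) ⟩
    ∑[ e < nE G ] (h (x e) *ℤ lookup g e) ∎)
    where
    open ≡-Reasoning
    *-if : ∀ a b {c} → a *ℤ (if b then c else 0ℤ) ≡ (if b then a *ℤ c else 0ℤ)
    *-if a true  = refl
    *-if a false = ℤ.*-zeroʳ a

  -- Grouped by vertex, both the h (tail e) g(e) and the h (head e) g(e) terms give
  -- the sum over v of h v times the flow through v.
  tension⊥flow : ∀ {f g} → IsTension G ρ f → IsFlow G ρ g → ∑[ e < nE G ] (lookup f e *ℤ lookup g e) ≡ 0ℤ
  tension⊥flow {f} {g} (h , tension) flow = +-cancelʳ (begin
    ∑[ e < nE G ] (lookup f e *ℤ lookup g e) +ℤ ∑[ e < nE G ] (h (head e) *ℤ lookup g e)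
      ≡⟨ ∑-distrib-+ (λ e → lookup f e *ℤ lookup g e) (λ e → h (head e) *ℤ lookup g e) ⟨
    ∑[ e < nE G ] (lookup f e *ℤ lookup g e +ℤ h (head e) *ℤ lookup g e)
      ≡⟨ sum-cong-≗ (λ e → trans (cong (λ d → d *ℤ lookup g e +ℤ h (head e) *ℤ lookup g e) (tension e))
                                  (difference-telescopes (h (tail e)) (h (head e)) (lookup g e))) ⟩
    ∑[ e < nE G ] (h (tail e) *ℤ lookup g e)
      ≡⟨ ∑-by-endpoint tail h g ⟩
    ∑[ v < nV G ] (h v *ℤ endpointSum tail g v)
      ≡⟨ sum-cong-≗ (λ v → cong (h v *ℤ_) (flow v)) ⟨
    ∑[ v < nV G ] (h v *ℤ endpointSum head g v)
      ≡⟨ ∑-by-endpoint head h g ⟨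
    ∑[ e < nE G ] (h (head e) *ℤ lookup g e) ∎)
    where
    open ≡-Reasoning
    difference-telescopes : ∀ a b c → (a - b) *ℤ c +ℤ b *ℤ c ≡ a *ℤ c
    difference-telescopes = solve-∀
    +-cancelʳ : ∀ {a b} → a +ℤ b ≡ b → a ≡ 0ℤ
    +-cancelʳ {a} {b} a+b≡b = trans (i≡i+j-j a b) (trans (cong (_- b) a+b≡b) (ℤ.+-inverseʳ b))

  endpointSum-indicator : ∀ (x : Fin (nE G) → Fin (nV G)) D v →
    endpointSum x (indicator D) v ≡ + sumFin (λ e → if lookup D e then (if does (x e ≟ v) then 1 else 0) else 0)
  endpointSum-indicator x D v = trans
    (sumFinℤ-cong λ e → trans (cong (λ d → if does (x e ≟ v) then d else 0ℤ) (lookup-map e toℤ D))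
                              (toℤ-if (does (x e ≟ v)) (lookup D e)))
    (sumFinℤ-+ λ e → if lookup D e then (if does (x e ≟ v) then 1 else 0) else 0)
    where
    toℤ-if : ∀ b d → (if b then toℤ d else 0ℤ) ≡ + (if d then (if b then 1 else 0) else 0)
    toℤ-if false false = refl
    toℤ-if false true  = refl
    toℤ-if true  false = refl
    toℤ-if true  true  = refl

  flow⇔eulerian : ∀ {D} → IsFlow G ρ (indicator D) ⇔ IsDirectedEulerian G ρ D
  flow⇔eulerian {D} = mk⇔
    (λ flow v → ℤ.+-injective
      (trans (sym (endpointSum-indicator head D v)) (trans (flow v) (endpointSum-indicator tail D v))))
    (λ eul v →
      trans (endpointSum-indicator head D v) (trans (cong +_ (eul v)) (sym (endpointSum-indicator tail D v))))

  locallyDirected⊥eulerian : ∀ {C D} → IsLocallyDirectedCut G ρ C → IsDirectedEulerian G ρ D → Disjoint C D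
  locallyDirected⊥eulerian {C} {D} ldc eul =
    disjoint⁺ λ e → count≡0⇒false (sumFin≡0⇒≡0 common (ℤ.+-injective common≡0) e)
    where
    open ≡-Reasoning
    common : Fin (nE G) → ℕ
    common e = if lookup C e ∧ lookup D e then 1 else 0
    toℤ-* : ∀ a b → toℤ a *ℤ toℤ b ≡ + (if a ∧ b then 1 else 0)
    toℤ-* false false = refl
    toℤ-* false true  = refl
    toℤ-* true  false = refl
    toℤ-* true  true  = refl
    common≡0 : + sumFin common ≡ 0ℤ
    common≡0 = begin
      + sumFin common
        ≡⟨ sumFinℤ-+ common ⟨
      sumFinℤ (λ e → + common e)
        ≡⟨ sumFinℤ-cong (λ e → trans (cong₂ _*ℤ_ (lookup-map e toℤ C) (lookup-map e toℤ D))
                                      (toℤ-* (lookup C e) (lookup D e))) ⟨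
      sumFinℤ (λ e → lookup (indicator C) e *ℤ lookup (indicator D) e)
        ≡⟨ sumFinℤ≡∑ (λ e → lookup (indicator C) e *ℤ lookup (indicator D) e) ⟩
      ∑[ e < nE G ] (lookup (indicator C) e *ℤ lookup (indicator D) e)
        ≡⟨ tension⊥flow {indicator C} {indicator D}
             (Equivalence.from (tension⇔locallyDirected {C}) ldc)
             (Equivalence.from (flow⇔eulerian {D}) eul) ⟩
      0ℤ
        ∎
    count≡0⇒false : ∀ {b} → (if b then 1 else 0) ≡ 0 → b ≡ false
    count≡0⇒false {false} _ = refl

-- Counting

module Counting (G : Graph) (ρ : Orientation G) where

  diffSet-involutive : ∀ σ → diffSet G ρ (diffSet G ρ σ) ≡ σ
  diffSet-involutive σ = lookup-ext λ e →
    trans (lookup-zipWith _xor_ e ρ (diffSet G ρ σ))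
      (trans (cong (lookup ρ e xor_) (lookup-zipWith _xor_ e ρ σ))
        (trans (sym (xor-assoc (lookup ρ e) (lookup ρ e) (lookup σ e)))
          (cong (_xor lookup σ e) (xor-same (lookup ρ e)))))

  diffSet-injective : ∀ {σ τ} → diffSet G ρ σ ≡ diffSet G ρ τ → σ ≡ τ
  diffSet-injective {σ} {τ} eq =
    trans (sym (diffSet-involutive σ)) (trans (cong (diffSet G ρ) eq) (diffSet-involutive τ))

  eulerian? : Decidable (IsDirectedEulerian G ρ)
  eulerian? D = all? λ v → indeg G ρ D v ℕ.≟ outdeg G ρ D v

  cuts eulerians : List (EdgeSet G)
  cuts      = filter (locallyDirected? G ρ) (allSubsets (nE G))
  eulerians = filter eulerian? (allSubsets (nE G))

  pairs : List (EdgeSet G × EdgeSet G)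
  pairs = cartesianProduct cuts eulerians

  ∈-pairs : ∀ {C D} → (C , D) ∈ˡ pairs → IsLocallyDirectedCut G ρ C × IsDirectedEulerian G ρ D
  ∈-pairs CD∈ = let (C∈ , D∈) = ∈-cartesianProduct⁻ cuts eulerians CD∈ in
    Equivalence.to (∈-filter-allSubsets (locallyDirected? G ρ)) C∈ , Equivalence.to (∈-filter-allSubsets eulerian?) D∈

  pairs⁺ : ∀ {C D} → IsLocallyDirectedCut G ρ C → IsDirectedEulerian G ρ D → (C , D) ∈ˡ pairs
  pairs⁺ ldc eul = ∈-cartesianProduct⁺ (Equivalence.from (∈-filter-allSubsets (locallyDirected? G ρ)) ldc)
                                       (Equivalence.from (∈-filter-allSubsets eulerian?) eul)

  pairs-unique : Unique pairs
  pairs-unique = Unique.cartesianProduct⁺ (Unique.filter⁺ (locallyDirected? G ρ) (allSubsets-unique (nE G)))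
                                          (Unique.filter⁺ eulerian? (allSubsets-unique (nE G)))

  hasCount-diffSet : ∀ {P : EdgeSet G → Set} (P? : Decidable P) →
                     HasCount (λ σ → P (diffSet G ρ σ)) (length (filter P? (allSubsets (nE G))))
  hasCount-diffSet P? = hasCount-map (diffSet G ρ) (Unique.filter⁺ P? (allSubsets-unique (nE G)))
    (λ _ _ → diffSet-injective) λ σ → ∈-filter-allSubsets P? ⇔-∘ ∈-map-involutive diffSet-involutive

  hasCount-cutEquiv : HasCount (CutEquiv G ρ) (length cuts)
  hasCount-cutEquiv = hasCount-diffSet (locallyDirected? G ρ)

  hasCount-eulerEquiv : HasCount (EulerEquiv G ρ) (length eulerians)
  hasCount-eulerEquiv = hasCount-diffSet eulerian?

  hasCount-cutEulerEquiv : HasCount (CutEulerEquiv G ρ) (length pairs)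
  hasCount-cutEulerEquiv = hasCount-map join pairs-unique join-injective λ σ → mk⇔ (to σ) (from σ)
    where
    join : EdgeSet G × EdgeSet G → Orientation G
    join (C , D) = diffSet G ρ (C ∪ D)
    join-injective : ∀ {x y} → x ∈ˡ pairs → y ∈ˡ pairs → join x ≡ join y → x ≡ y
    join-injective {C , D} {C′ , D′} CD∈ CD′∈ eq =
      let (ldc , eul) = ∈-pairs CD∈ ; (ldc′ , eul′) = ∈-pairs CD′∈
          (C≡C′ , D≡D′) = ∪-injective-disjoint (locallyDirected⊥eulerian G ρ ldc eul′) (locallyDirected⊥eulerian G ρ ldc′ eul)
                                               (diffSet-injective eq)
      in cong₂ _,_ C≡C′ D≡D′
    to : ∀ σ → σ ∈ˡ mapˡ join pairs → CutEulerEquiv G ρ σ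
    to σ σ∈ with ∈-map⁻ join σ∈
    ... | (C , D) , CD∈ , refl = let (ldc , eul) = ∈-pairs CD∈ in
      C , D , ldc , eul , locallyDirected⊥eulerian G ρ ldc eul , sym (diffSet-involutive (C ∪ D))
    from : ∀ σ → CutEulerEquiv G ρ σ → σ ∈ˡ mapˡ join pairs
    from σ (C , D , ldc , eul , _ , C∪D≡) =
      subst (_∈ˡ _) (trans (cong (diffSet G ρ) C∪D≡) (diffSet-involutive σ)) (∈-map⁺ join (pairs⁺ ldc eul))

  kappaBar-pairs : KappaBar G ρ 1 1 (length pairs)
  kappaBar-pairs = hasCount-map indicators pairs-unique
    (λ _ _ eq → cong₂ _,_ (indicator-injective (cong proj₁ eq)) (indicator-injective (cong proj₂ eq)))
    λ fg → mk⇔ (to fg) (from fg)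
    where
    indicators : EdgeSet G × EdgeSet G → Vec ℤ (nE G) × Vec ℤ (nE G)
    indicators (C , D) = indicator C , indicator D
    to : ∀ fg → fg ∈ˡ mapˡ indicators pairs →
         IsTension G ρ (proj₁ fg) × IsFlow G ρ (proj₂ fg) × Bounded 1 (proj₁ fg) × Bounded 1 (proj₂ fg)
    to fg fg∈ with ∈-map⁻ indicators fg∈
    ... | (C , D) , CD∈ , refl = let (ldc , eul) = ∈-pairs CD∈ in
      Equivalence.from (tension⇔locallyDirected G ρ {C}) ldc ,
      Equivalence.from (flow⇔eulerian G ρ {D}) eul , indicator-bounded C , indicator-bounded D
    from : ∀ fg → IsTension G ρ (proj₁ fg) × IsFlow G ρ (proj₂ fg) × Bounded 1 (proj₁ fg) × Bounded 1 (proj₂ fg) →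
           fg ∈ˡ mapˡ indicators pairs
    from (f , g) (tension , flow , f-bounded , g-bounded) =
      subst (_∈ˡ _) (cong₂ _,_ f≡ g≡) (∈-map⁺ indicators (pairs⁺ ldc eul))
      where
      f≡ : indicator (support f) ≡ f
      f≡ = indicator-support {f = f} f-bounded
      g≡ : indicator (support g) ≡ g
      g≡ = indicator-support {f = g} g-bounded
      ldc : IsLocallyDirectedCut G ρ (support f)
      ldc = Equivalence.to (tension⇔locallyDirected G ρ {support f}) (subst (IsTension G ρ) (sym f≡) tension)
      eul : IsDirectedEulerian G ρ (support g)
      eul = Equivalence.to (flow⇔eulerian G ρ {support g}) (subst (IsFlow G ρ) (sym g≡) flow)

proposition4p6 : (G : Graph) (ρ : Orientation G) →
    ∃ λ (nce : ℕ) → ∃ λ (ncu : ℕ) → ∃ λ (neu : ℕ) → ∃ λ (nκ : ℕ) →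
      HasCount (CutEulerEquiv G ρ) nce × HasCount (CutEquiv G ρ) ncu ×
      HasCount (EulerEquiv G ρ) neu × KappaBar G ρ 1 1 nκ ×
      nce ≡ ncu * neu × nce ≡ nκ
proposition4p6 G ρ =
  length pairs , length cuts , length eulerians , length pairs ,
  hasCount-cutEulerEquiv , hasCount-cutEquiv , hasCount-eulerEquiv , kappaBar-pairs ,
  length-cartesianProduct cuts eulerians , refl
  where open Counting G ρ
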